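{- Let $h\ge 4$ be an integer and let $\hat e(h)=4/3$ if $h\equiv 1\pmod 3$, $\hat e(h)=1$ if $h\equiv 0\pmod 3$, and $\hat e(h)=2/3$ if $h\equiv 2 \pmod 3$. Then $e_{max}(h,4)\ge \hat e(h)$. Moreover, if $h>4$, there exists a snake $S\in\mathcal W^2_{h\times 4}$ with $e(S)=\hat e(h)$.
   Context: A 2-dimensional binary word of dimensions $h\times w$ is an $h\times w$ matrix $W$ with entries in $\{\square,\blacksquare\}$ (filled cells $\blacksquare$, empty cells $\square$); $|W|_\blacksquare$ is its number of filled cells. Positions $(i,j),(i',j')$ are adjacent if $|i-i'|+|j-j'|=1$; the degree of a filled cell is the number of filled cells adjacent to it. $\mathcal W^2_{h\times w}$ is the set of $h\times w$ words in which every filled cell has degree at most $2$. The excess of an $h\times w$ word $W$ is $e(W)=|W|_\blacksquare-2hw/3$, and $e_{max}(h,w)=\max\{e(W): W\in\mathcal W^2_{h\times w}\}$. A snake is a word whose set of filled cells is nonempty and induces a path (chain) in the grid graph on the positions of the word (vertices = positions, edges = adjacent pairs). -}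

module Defs where

open import Data.Nat as ℕ using (ℕ; zero; suc; _∸_; _%_)
open import Data.Fin as Fin using (Fin; toℕ)
open import Data.Bool using (Bool; true; false; _∧_; if_then_else_)
open import Data.Product using (_×_; _,_; ∃; Σ-syntax)
open import Data.List using (List; []; _∷_; length; lookup)
open import Data.List.Relation.Unary.Unique.Propositional using (Unique)
open import Data.List.Relation.Unary.Linked using (Linked)
open import Data.List.Membership.Propositional using (_∈_)
open import Data.Integer using (+_)
open import Data.Rational using (ℚ; _/_; _-_)
open import Relation.Binary.PropositionalEquality using (_≡_; _≢_)
open import Relation.Nullary using (¬_)
open import Relation.Nullary.Decidable using (⌊_⌋)
open import Function.Bundles using (_⇔_)

-- An h × w binary word: true = filled (■), false = empty (□).
Word : ℕ → ℕ → Set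
Word h w = Fin h → Fin w → Bool

Pos : ℕ → ℕ → Set
Pos h w = Fin h × Fin w

Filled : ∀ {h w} → Word h w → Pos h w → Set
Filled W (i , j) = W i j ≡ true

dist : ℕ → ℕ → ℕ
dist a b = (a ∸ b) ℕ.+ (b ∸ a)

Adjacent : ∀ {h w} → Pos h w → Pos h w → Set
Adjacent (i , j) (i' , j') = dist (toℕ i) (toℕ i') ℕ.+ dist (toℕ j) (toℕ j') ≡ 1

adjacentᵇ : ∀ {h w} → Pos h w → Pos h w → Bool
adjacentᵇ (i , j) (i' , j') = ⌊ dist (toℕ i) (toℕ i') ℕ.+ dist (toℕ j) (toℕ j') ℕ.≟ 1 ⌋

countRow : ∀ {w} → (Fin w → Bool) → ℕ
countRow {zero} r = 0
countRow {suc w} r = (if r Fin.zero then 1 else 0) ℕ.+ countRow (λ j → r (Fin.suc j))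

filledCount : ∀ {h w} → Word h w → ℕ
filledCount {zero} W = 0
filledCount {suc h} W = countRow (W Fin.zero) ℕ.+ filledCount (λ i → W (Fin.suc i))

degree : ∀ {h w} → Word h w → Pos h w → ℕ
degree W p = filledCount (λ i j → W i j ∧ adjacentᵇ p (i , j))

InW2 : ∀ {h w} → Word h w → Set
InW2 {h} {w} W = (p : Pos h w) → Filled W p → degree W p ℕ.≤ 2

excess : ∀ {h w} → Word h w → ℚ
excess {h} {w} W = (+ filledCount W) / 1 - (+ (2 ℕ.* h ℕ.* w)) / 3

eHat : ℕ → ℚ
eHat h with h % 3
... | 0 = + 1 / 1
... | 1 = + 4 / 3
... | _ = + 2 / 3

-- The filled cells of W induce a path: there is a nonempty list of distinct
-- positions, listing exactly the filled cells, in which consecutive entries are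
-- adjacent and non-consecutive entries are not adjacent.
IsSnake : ∀ {h w} → Word h w → Set
IsSnake {h} {w} W =
  Σ[ ps ∈ List (Pos h w) ]
    ( ps ≢ []
    × Unique ps
    × ((p : Pos h w) → Filled W p ⇔ p ∈ ps)
    × Linked Adjacent ps
    × ((a b : Fin (length ps)) → suc (toℕ a) ℕ.< toℕ b
         → ¬ Adjacent (lookup ps a) (lookup ps b)) )

{-# OPTIONS --safe #-}

-- For h = 4 the outline of the 4 × 4 square has 12 cells, i.e. excess 4/3.  For h > 4 the
-- snakes are built from "hairpins": induced paths from (0,0) to (0,2) that go down the left
-- half of the strip and come back up the right half.  Wrapping a hairpin in a 6-row frame
-- (a zigzag in columns 0–1 leading down to the hairpin shifted by 6 rows, and a zigzag in
-- columns 2–3 leading back up) adds 16 = 8·6/3 cells, so the excess stays 1; starting from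
-- hairpins of heights 3 and 6 this covers every height divisible by 3.  Putting a cap of 2
-- rows and 5 cells, or of 4 rows and 11 cells, on top of a hairpin changes the excess by
-- -1/3 or +1/3, which covers the other two residues.  Every gluing is checked locally: cells
-- two rows apart are never adjacent, so only the rows where two pieces meet matter; the
-- finitely many concrete pieces are checked by computation.

module Submission where

open import Defs
import Data.Rational
open import Data.Nat using (ℕ; _<_)
open import Data.Product using (_×_; Σ-syntax)
open import Relation.Binary.PropositionalEquality using (_≡_)

open import Data.Bool using (Bool; true; false; _∧_; _∨_; T; if_then_else_)
import Data.Bool.Properties as Bool
open import Data.Empty using (⊥; ⊥-elim)
open import Data.Fin as Fin using (Fin; zero; suc; toℕ; fromℕ<)
import Data.Fin.Properties as Fin
import Data.Integer as ℤ
import Data.Integer.Properties as ℤ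
import Data.Integer.Tactic.RingSolver as ℤ-Solver
open import Data.List using (List; []; _∷_; _++_; [_]; map; length; lookup; filter)
open import Data.List.Properties
  using (filter-accept; filter-reject; filter-none; length-++; length-map; map-++; ++-assoc)
import Data.List.Membership.DecPropositional as DecMembership
open import Data.List.Membership.Propositional using (_∈_)
open import Data.List.Membership.Propositional.Properties using (∈-lookup; ∈-filter⁺)
open import Data.List.Relation.Unary.All as All using (All; []; _∷_; all?)
import Data.List.Relation.Unary.All.Properties as All
open import Data.List.Relation.Unary.AllPairs as AllPairs using (AllPairs; []; _∷_)
open import Data.List.Relation.Unary.Any using (here; there)
open import Data.List.Relation.Unary.Linked using (Linked; []; [-]; _∷_)
open import Data.List.Relation.Unary.Unique.Propositional using (Unique)
import Data.List.Relation.Unary.Unique.Propositional.Properties as Unique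
open import Data.Nat as ℕ using (zero; suc; _+_; _*_; _∸_; _≤_; z≤n; s≤s; _%_)
open import Data.Nat.DivMod using (m≡m%n+[m/n]*n; m%n<n; [m+kn]%n≡m%n)
import Data.Nat.Properties as ℕ
open import Algebra.Properties.CommutativeSemigroup ℕ.+-commutativeSemigroup using (interchange)
import Data.Nat.Tactic.RingSolver as ℕ-Solver
open import Data.Product using (_,_; proj₁; proj₂; map₁)
open import Data.Product.Properties using (≡-dec; ×-≡,≡→≡; ×-≡,≡←≡)
open import Data.Rational using (_/_; _-_; toℚᵘ)
open import Data.Rational.Properties as ℚ using (toℚᵘ-injective; toℚᵘ-homo-+; toℚᵘ-homo‿-; toℚᵘ-fromℚᵘ)
import Data.Rational.Unnormalised as ℚᵘ
import Data.Rational.Unnormalised.Properties as ℚᵘ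
open import Data.Sum using (inj₁; inj₂)
open import Data.Unit using (⊤; tt)
open import Function using (_on_; _∘_; id; _⇔_; mk⇔; Equivalence)
open import Level using (0ℓ)
open import Relation.Binary using (Rel; Decidable; DecidableEquality; Symmetric; Irreflexive)
open import Relation.Binary.PropositionalEquality
  using (_≢_; refl; sym; trans; cong; cong₂; subst; ≢-sym; module ≡-Reasoning)
open import Relation.Nullary using (¬_; Dec; yes; no; does; ¬?; _×-dec_; _→-dec_; from-yes)
open import Relation.Nullary.Decidable using (toWitness; map′)

-- Induced paths in a graph given by an adjacency relation

module _ {A : Set} where

  Apart : Rel A 0ℓ → A → A → Set
  Apart R x y = x ≢ y × ¬ R x y

  AllApart : Rel A 0ℓ → List A → List A → Set
  AllApart R xs ys = All (λ x → All (Apart R x) ys) xs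

  InducedPath : Rel A 0ℓ → List A → Set
  InducedPath R []           = ⊤
  InducedPath R (x ∷ [])     = ⊤
  InducedPath R (x ∷ y ∷ zs) = R x y × All (Apart R x) zs × InducedPath R (y ∷ zs)

module _ {A : Set} {R : Rel A 0ℓ} where

  apart? : DecidableEquality A → Decidable R → Decidable (Apart R)
  apart? _≟_ R? x y = ¬? (x ≟ y) ×-dec ¬? (R? x y)

  inducedPath? : DecidableEquality A → Decidable R → (xs : List A) → Dec (InducedPath R xs)
  inducedPath? _≟_ R? []           = yes tt
  inducedPath? _≟_ R? (x ∷ [])     = yes tt
  inducedPath? _≟_ R? (x ∷ y ∷ zs) =
    R? x y ×-dec all? (apart? _≟_ R? x) zs ×-dec inducedPath? _≟_ R? (y ∷ zs)

  Apart-sym : Symmetric R → Symmetric (Apart R)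
  Apart-sym R-sym (x≢y , ¬xRy) = ≢-sym x≢y , ¬xRy ∘ R-sym

  AllApart-sym : Symmetric R → ∀ {xs ys} → AllApart R xs ys → AllApart R ys xs
  AllApart-sym R-sym = All.map (All.map (Apart-sym R-sym)) ∘ All.All-swap

  InducedPath-tail : ∀ {x xs} → InducedPath R (x ∷ xs) → InducedPath R xs
  InducedPath-tail {xs = []}    _           = tt
  InducedPath-tail {xs = _ ∷ _} (_ , _ , p) = p

  InducedPath⇒Linked : ∀ {xs} → InducedPath R xs → Linked R xs
  InducedPath⇒Linked {[]}        _           = []
  InducedPath⇒Linked {_ ∷ []}    _           = [-]
  InducedPath⇒Linked {_ ∷ _ ∷ _} (r , _ , p) = r ∷ InducedPath⇒Linked p

  InducedPath⇒Unique : Irreflexive _≡_ R → ∀ {xs} → InducedPath R xs → Unique xs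
  InducedPath⇒Unique R-irrefl {[]}        _           = []
  InducedPath⇒Unique R-irrefl {_ ∷ []}    _           = [] ∷ []
  InducedPath⇒Unique R-irrefl {_ ∷ _ ∷ _} (r , a , p) =
    ((λ x≡y → R-irrefl x≡y r) ∷ All.map proj₁ a) ∷ InducedPath⇒Unique R-irrefl p

  InducedPath⇒chordless : ∀ {xs} → InducedPath R xs → (a b : Fin (length xs)) →
                          suc (toℕ a) < toℕ b → ¬ R (lookup xs a) (lookup xs b)
  InducedPath⇒chordless {_ ∷ _ ∷ _} _           zero    (suc zero)    (s≤s ())
  InducedPath⇒chordless {_ ∷ _ ∷ _} (_ , a , _) zero    (suc (suc b)) _ = proj₂ (All.lookup a (∈-lookup b))
  InducedPath⇒chordless {_ ∷ _ ∷ _} (_ , _ , p) (suc a) (suc b)       (s≤s a+1<b) =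
    InducedPath⇒chordless p a b a+1<b

  InducedPath-++ : ∀ {xs x y ys} → InducedPath R (xs ++ [ x ]) → InducedPath R (y ∷ ys) →
                   R x y → All (Apart R x) ys → AllApart R xs (y ∷ ys) →
                   InducedPath R (xs ++ x ∷ y ∷ ys)
  InducedPath-++ {[]}         _             q r a _        = r , a , q
  InducedPath-++ {_ ∷ []}     (r′ , _ , _)  q r a (b ∷ []) = r′ , b , InducedPath-++ {[]} tt q r a []
  InducedPath-++ {_ ∷ v ∷ ws} (r′ , a′ , p) q r a (b ∷ bs) =
    r′ , All.++⁺ (All.++⁻ˡ ws a′) (All.head (All.++⁻ʳ ws a′) ∷ b) , InducedPath-++ {v ∷ ws} p q r a bs

  module _ (R? : Decidable R) (R-sym : Symmetric R) (R-irrefl : Irreflexive _≡_ R) where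

    private
      head-degree≤1 : ∀ {x xs} → InducedPath R (x ∷ xs) → length (filter (R? x) xs) ≤ 1
      head-degree≤1 {x} {[]}     _           = z≤n
      head-degree≤1 {x} {y ∷ zs} (r , a , _)
        rewrite filter-accept (R? x) {xs = zs} r | filter-none (R? x) (All.map proj₂ a) = s≤s z≤n

    InducedPath-degree≤2 : ∀ {x xs} → InducedPath R xs → x ∈ xs → length (filter (R? x) xs) ≤ 2
    InducedPath-degree≤2 {x} {_ ∷ xs} p (here refl)
      rewrite filter-reject (R? x) {xs = xs} (R-irrefl refl) = ℕ.m≤n⇒m≤1+n (head-degree≤1 p)
    InducedPath-degree≤2 {x} {y ∷ xs} p (there x∈xs) with R? x y
    ... | no _  = InducedPath-degree≤2 (InducedPath-tail p) x∈xs
    ... | yes r = s≤s (successor-degree≤1 xs p x∈xs)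
      where
      successor-degree≤1 : ∀ xs → InducedPath R (y ∷ xs) → x ∈ xs → length (filter (R? x) xs) ≤ 1
      successor-degree≤1 (_ ∷ zs) (_ , _ , p) (here refl)
        rewrite filter-reject (R? x) {xs = zs} (R-irrefl refl) = head-degree≤1 p
      successor-degree≤1 (_ ∷ _) (_ , a , _) (there x∈zs) = ⊥-elim (proj₂ (All.lookup a x∈zs) (R-sym r))

module _ {A B : Set} {f : A → B} where

  InducedPath-map⁻ : ∀ {R : Rel B 0ℓ} {xs} → InducedPath R (map f xs) → InducedPath (R on f) xs
  InducedPath-map⁻ {xs = []}        _           = tt
  InducedPath-map⁻ {xs = _ ∷ []}    _           = tt
  InducedPath-map⁻ {xs = _ ∷ _ ∷ _} (r , a , p) =
    r , All.map (λ (fx≢fy , ¬r) → fx≢fy ∘ cong f , ¬r) (All.map⁻ a) , InducedPath-map⁻ p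

  InducedPath-map⁺ : ∀ {R : Rel A 0ℓ} {S : Rel B 0ℓ} → (∀ {x y} → f x ≡ f y → x ≡ y) →
                     (∀ {x y} → R x y → S (f x) (f y)) → (∀ {x y} → S (f x) (f y) → R x y) →
                     ∀ {xs} → InducedPath R xs → InducedPath S (map f xs)
  InducedPath-map⁺ inj to from {[]}        _           = tt
  InducedPath-map⁺ inj to from {_ ∷ []}    _           = tt
  InducedPath-map⁺ inj to from {_ ∷ _ ∷ _} (r , a , p) =
    to r , All.map⁺ (All.map (λ (x≢y , ¬r) → x≢y ∘ inj , ¬r ∘ from) a) , InducedPath-map⁺ inj to from p

AllPairs-∷ʳ⁻ : ∀ {A : Set} {R : Rel A 0ℓ} {xs x} → AllPairs R (xs ++ [ x ]) → All (λ u → R u x) xs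
AllPairs-∷ʳ⁻ {xs = []}    _        = []
AllPairs-∷ʳ⁻ {xs = _ ∷ _} (r ∷ rs) = proj₂ (All.∷ʳ⁻ r) ∷ AllPairs-∷ʳ⁻ rs

Cell : Set
Cell = ℕ × ℕ

row col : Cell → ℕ
row = proj₁
col = proj₂

_≟ᶜ_ : DecidableEquality Cell
_≟ᶜ_ = ≡-dec ℕ._≟_ ℕ._≟_

Adj : Rel Cell 0ℓ
Adj (a , b) (c , d) = dist a c + dist b d ≡ 1

adj? : Decidable Adj
adj? (a , b) (c , d) = dist a c + dist b d ℕ.≟ 1

dist-comm : ∀ m n → dist m n ≡ dist n m
dist-comm m n = ℕ.+-comm (m ∸ n) (n ∸ m)

dist-self : ∀ m → dist m m ≡ 0
dist-self m = cong₂ _+_ (ℕ.n∸n≡0 m) (ℕ.n∸n≡0 m)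

dist≡0⇒≡ : ∀ {m n} → dist m n ≡ 0 → m ≡ n
dist≡0⇒≡ {zero}  {zero}  _ = refl
dist≡0⇒≡ {suc m} {suc n} e = cong suc (dist≡0⇒≡ e)

dist-+ʳ : ∀ k m n → dist (m + k) (n + k) ≡ dist m n
dist-+ʳ k m n rewrite ℕ.+-comm m k | ℕ.+-comm n k =
  cong₂ _+_ (ℕ.[m+n]∸[m+o]≡n∸o k m n) (ℕ.[m+n]∸[m+o]≡n∸o k n m)

Adj-sym : Symmetric Adj
Adj-sym {a , b} {c , d} = subst (_≡ 1) (cong₂ _+_ (dist-comm a c) (dist-comm b d))

Adj-irrefl : Irreflexive _≡_ Adj
Adj-irrefl {a , b} refl adj with () ← trans (sym (cong₂ _+_ (dist-self a) (dist-self b))) adj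

below : Cell → Cell
below (r , c) = (suc r , c)

Adj-below : ∀ x → Adj x (below x)
Adj-below (zero  , c) = cong suc (dist-self c)
Adj-below (suc r , c) = Adj-below (r , c)

Adj-downward : ∀ {x y} → row x < row y → Adj x y → y ≡ below x
Adj-downward {zero , b} {suc c , d} _ adj with refl ← ℕ.m+n≡0⇒m≡0 c (ℕ.suc-injective adj) =
  cong (1 ,_) (sym (dist≡0⇒≡ (ℕ.m+n≡0⇒n≡0 c (ℕ.suc-injective adj))))
Adj-downward {suc a , b} {suc c , d} (s≤s a<c) adj = cong (map₁ suc) (Adj-downward {a , b} {c , d} a<c adj)

Apart-below : ∀ {x y} → row x < row y → below x ≢ y → Apart Adj x y
Apart-below x<y x↓≢y = (λ { refl → ℕ.<-irrefl refl x<y }) , x↓≢y ∘ sym ∘ Adj-downward x<y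

Apart-far : ∀ {x y} → suc (row x) < row y → Apart Adj x y
Apart-far x+1<y = Apart-below (ℕ.<-trans (ℕ.n<1+n _) x+1<y) (λ { refl → ℕ.<-irrefl refl x+1<y })

AllApart-far : ∀ {k xs ys} → All (λ u → suc (row u) < k) xs → All (λ v → k ≤ row v) ys → AllApart Adj xs ys
AllApart-far xs-above ys-below =
  All.map (λ u+1<k → All.map (λ k≤v → Apart-far (ℕ.<-≤-trans u+1<k k≤v)) ys-below) xs-above

All-Apart-below : ∀ {k u ys} → row u < k → All (λ v → k ≤ row v) ys → All (below u ≢_) ys →
                  All (Apart Adj u) ys
All-Apart-below u<k ys-below u↓∉ys =
  All.zipWith (λ (k≤v , u↓≢v) → Apart-below (ℕ.<-≤-trans u<k k≤v) u↓≢v) (ys-below , u↓∉ys)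

-- Adding k on the right makes shift k (0 , c) reduce to (k , c).
shift : ℕ → Cell → Cell
shift k (r , c) = (r + k , c)

shift-injective : ∀ k {x y} → shift k x ≡ shift k y → x ≡ y
shift-injective k {a , b} {c , d} eq = cong₂ _,_ (ℕ.+-cancelʳ-≡ k a c (cong row eq)) (cong col eq)

Adj-shift : ∀ k x y → Adj (shift k x) (shift k y) ≡ Adj x y
Adj-shift k (a , b) (c , d) = cong (λ δ → δ + dist b d ≡ 1) (dist-+ʳ k a c)

InducedPath-shift : ∀ k {xs} → InducedPath Adj xs → InducedPath Adj (map (shift k) xs)
InducedPath-shift k = InducedPath-map⁺ (shift-injective k)
  (λ {x} {y} → subst id (sym (Adj-shift k x y))) (λ {x} {y} → subst id (Adj-shift k x y))

shift-rows : ∀ k xs → All (λ v → k ≤ row v) (map (shift k) xs)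
shift-rows k xs = All.map⁺ (All.universal (λ (r , _) → ℕ.m≤n+m k r) xs)

All-≢-shift : ∀ k {c xs} → All (c ≢_) xs → All (shift k c ≢_) (map (shift k) xs)
All-≢-shift k = All.map⁺ ∘ All.map (λ c≢x → c≢x ∘ shift-injective k)

inducedPathᶜ? : (cs : List Cell) → Dec (InducedPath Adj cs)
inducedPathᶜ? = inducedPath? _≟ᶜ_ adj?

allApartᶜ? : (cs ds : List Cell) → Dec (AllApart Adj cs ds)
allApartᶜ? cs ds = all? (λ c → all? (apart? _≟ᶜ_ adj? c) ds) cs

above? : ∀ k → (cs : List Cell) → Dec (All (λ c → suc (row c) < k) cs)
above? k = all? (λ c → suc (row c) ℕ.<? k)

-- Counting filled cells

Disjoint : ∀ {h w} → Word h w → Word h w → Set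
Disjoint W V = ∀ i j → T (W i j) → T (V i j) → ⊥

_∪_ : ∀ {h w} → Word h w → Word h w → Word h w
(W ∪ V) i j = W i j ∨ V i j

_⊆_ : ∀ {h w} → Word h w → Word h w → Set
W ⊆ V = ∀ i j → T (W i j) → T (V i j)

private
  bit : Bool → ℕ
  bit b = if b then 1 else 0

  bit-mono : ∀ {a b} → (T a → T b) → bit a ≤ bit b
  bit-mono {false} _ = z≤n
  bit-mono {true} {true} _ = ℕ.≤-refl
  bit-mono {true} {false} a⇒b = ⊥-elim (a⇒b _)

  bit-∨ : ∀ {a b} → (T a → T b → ⊥) → bit (a ∨ b) ≡ bit a + bit b
  bit-∨ {false} _ = refl
  bit-∨ {true} {false} _ = refl
  bit-∨ {true} {true} a#b = ⊥-elim (a#b _ _)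

countRow-false : ∀ {w} → countRow {w} (λ _ → false) ≡ 0
countRow-false {zero} = refl
countRow-false {suc w} = countRow-false {w}

countRow-mono : ∀ {w} {r s : Fin w → Bool} → (∀ j → T (r j) → T (s j)) → countRow r ≤ countRow s
countRow-mono {zero} _ = z≤n
countRow-mono {suc w} r⊆s = ℕ.+-mono-≤ (bit-mono (r⊆s zero)) (countRow-mono (r⊆s ∘ suc))

countRow-∨ : ∀ {w} {r s : Fin w → Bool} → (∀ j → T (r j) → T (s j) → ⊥) →
             countRow (λ j → r j ∨ s j) ≡ countRow r + countRow s
countRow-∨ {zero} _ = refl
countRow-∨ {suc w} {r} {s} r#s = trans (cong₂ _+_ (bit-∨ (r#s zero)) (countRow-∨ (r#s ∘ suc)))
  (interchange (bit (r zero)) (bit (s zero)) (countRow (r ∘ suc)) (countRow (s ∘ suc)))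

countRow-singleton : ∀ {w} (b : Fin w) → countRow (λ j → does (j Fin.≟ b)) ≡ 1
countRow-singleton {suc w} zero = cong suc (countRow-false {w})
countRow-singleton (suc b) = countRow-singleton b

filledCount-false : ∀ {h w} → filledCount {h} {w} (λ _ _ → false) ≡ 0
filledCount-false {zero} = refl
filledCount-false {suc h} {w} = cong₂ _+_ (countRow-false {w}) (filledCount-false {h})

filledCount-mono : ∀ {h w} {W V : Word h w} → W ⊆ V → filledCount W ≤ filledCount V
filledCount-mono {zero} _ = z≤n
filledCount-mono {suc h} W⊆V = ℕ.+-mono-≤ (countRow-mono (W⊆V zero)) (filledCount-mono (W⊆V ∘ suc))

filledCount-∪ : ∀ {h w} {W V : Word h w} → Disjoint W V → filledCount (W ∪ V) ≡ filledCount W + filledCount V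
filledCount-∪ {zero} _ = refl
filledCount-∪ {suc h} {w} {W} {V} W#V = trans (cong₂ _+_ (countRow-∨ (W#V zero)) (filledCount-∪ (W#V ∘ suc)))
  (interchange (countRow (W zero)) (countRow (V zero)) (filledCount (W ∘ suc)) (filledCount (V ∘ suc)))

filledCount-singleton : ∀ {h w} (a : Fin h) (b : Fin w) →
                        filledCount (λ i j → does (i Fin.≟ a) ∧ does (j Fin.≟ b)) ≡ 1
filledCount-singleton {suc h} {w} zero b = cong₂ _+_ (countRow-singleton b) (filledCount-false {h} {w})
filledCount-singleton {suc h} {w} (suc a) b = cong₂ _+_ (countRow-false {w}) (filledCount-singleton a b)

T-does⇒ : ∀ {A : Set} (a? : Dec A) → T (does a?) → A
T-does⇒ (yes a) _ = a

⇒T-does : ∀ {A : Set} (a? : Dec A) → A → T (does a?)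
⇒T-does (yes _) _ = tt
⇒T-does (no ¬a) a = ¬a a

-- Adjacent p q is definitionally Adj (toCell p) (toCell q), so induced paths of cells
-- transfer to positions by InducedPath-map⁻.
toCell : ∀ {h w} → Pos h w → Cell
toCell (i , j) = (toℕ i , toℕ j)

module _ {h w : ℕ} where

  -- Unlike Data.Product.Properties.≡-dec, this computes `does` to a conjunction of the two
  -- coordinate tests, which is the shape filledCount-singleton counts.
  _≟ₚ_ : DecidableEquality (Pos h w)
  (i , j) ≟ₚ (a , b) = map′ ×-≡,≡→≡ ×-≡,≡←≡ ((i Fin.≟ a) ×-dec (j Fin.≟ b))

  open DecMembership _≟ₚ_ using (_∈?_)

  wordOf : List (Pos h w) → Word h w
  wordOf ps i j = does ((i , j) ∈? ps)

  Filled-wordOf : ∀ {ps} p → Filled (wordOf ps) p ⇔ p ∈ ps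
  Filled-wordOf {ps} p with p ∈? ps
  ... | yes p∈ps = mk⇔ (λ _ → p∈ps) (λ _ → refl)
  ... | no  p∉ps = mk⇔ (λ ()) (⊥-elim ∘ p∉ps)

  filledCount-wordOf : ∀ {ps} → Unique ps → filledCount (wordOf ps) ≡ length ps
  filledCount-wordOf {[]}     _          = filledCount-false {h} {w}
  filledCount-wordOf {p ∷ ps} (p∉ps ∷ u) =
    trans (filledCount-∪ disjoint)
          (cong₂ _+_ (filledCount-singleton (proj₁ p) (proj₂ p)) (filledCount-wordOf u))
    where
    disjoint : Disjoint (λ i j → does ((i , j) ≟ₚ p)) (wordOf ps)
    disjoint i j q≡p q∈ps =
      All.lookup p∉ps (T-does⇒ ((i , j) ∈? ps) q∈ps) (sym (T-does⇒ ((i , j) ≟ₚ p) q≡p))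

  adjacent? : Decidable (Adjacent {h} {w})
  adjacent? p q = adj? (toCell p) (toCell q)

  Adjacent-sym : Symmetric (Adjacent {h} {w})
  Adjacent-sym {p} {q} = Adj-sym {toCell p} {toCell q}

  Adjacent-irrefl : Irreflexive _≡_ (Adjacent {h} {w})
  Adjacent-irrefl {p} {q} p≡q = Adj-irrefl {toCell p} {toCell q} (cong toCell p≡q)

  degree-wordOf : ∀ {ps} → Unique ps → ∀ p → degree (wordOf ps) p ≤ length (filter (adjacent? p) ps)
  degree-wordOf {ps} u p = ℕ.≤-trans (filledCount-mono neighbours⊆)
    (ℕ.≤-reflexive (filledCount-wordOf (Unique.filter⁺ (adjacent? p) u)))
    where
    neighbours⊆ : (λ i j → wordOf ps i j ∧ adjacentᵇ p (i , j)) ⊆ wordOf (filter (adjacent? p) ps)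
    neighbours⊆ i j t with Equivalence.to (Bool.T-∧ {wordOf ps i j}) t
    ... | q∈ps , p~q = ⇒T-does ((i , j) ∈? filter (adjacent? p) ps)
      (∈-filter⁺ (adjacent? p) (T-does⇒ ((i , j) ∈? ps) q∈ps) (toWitness {a? = adjacent? p (i , j)} p~q))

  wordOf-InW2 : ∀ {ps} → InducedPath Adjacent ps → InW2 (wordOf ps)
  wordOf-InW2 path p filled = ℕ.≤-trans (degree-wordOf (InducedPath⇒Unique Adjacent-irrefl path) p)
    (InducedPath-degree≤2 adjacent? (λ {p} {q} → Adjacent-sym {p} {q}) Adjacent-irrefl path
      (Equivalence.to (Filled-wordOf p) filled))

  wordOf-IsSnake : ∀ {ps} → InducedPath Adjacent ps → ps ≢ [] → IsSnake (wordOf ps)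
  wordOf-IsSnake {ps} path ps≢[] = ps , ps≢[] , InducedPath⇒Unique Adjacent-irrefl path , Filled-wordOf ,
    InducedPath⇒Linked path , InducedPath⇒chordless path

InGrid : ℕ → ℕ → Cell → Set
InGrid h w (r , c) = r < h × c < w

InGrid-mono : ∀ {h h′ w} → h ≤ h′ → ∀ {c} → InGrid h w c → InGrid h′ w c
InGrid-mono h≤h′ (r<h , c<w) = ℕ.<-≤-trans r<h h≤h′ , c<w

InGrid-shift : ∀ {h w} k {cs} → All (InGrid h w) cs → All (InGrid (k + h) w) (map (shift k) cs)
InGrid-shift {h} k = All.map⁺ ∘ All.map λ {(r , _)} (r<h , c<w) →
  subst (_< k + h) (ℕ.+-comm k r) (ℕ.+-monoʳ-< k r<h) , c<w

inGrid? : ∀ h w → (cs : List Cell) → Dec (All (InGrid h w) cs)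
inGrid? h w = all? (λ (r , c) → (r ℕ.<? h) ×-dec (c ℕ.<? w))

positions : ∀ {h w} (cs : List Cell) → All (InGrid h w) cs → Σ[ ps ∈ List (Pos h w) ] map toCell ps ≡ cs
positions []             []                 = [] , refl
positions ((r , c) ∷ cs) ((r<h , c<w) ∷ in-grid) with positions cs in-grid
... | ps , refl = (fromℕ< r<h , fromℕ< c<w) ∷ ps ,
                  cong (_∷ map toCell ps) (cong₂ _,_ (Fin.toℕ-fromℕ< r<h) (Fin.toℕ-fromℕ< c<w))

snake-from-cells : ∀ {h w} (cs : List Cell) → InducedPath Adj cs → cs ≢ [] → All (InGrid h w) cs →
                   Σ[ S ∈ Word h w ] (InW2 S × IsSnake S × filledCount S ≡ length cs)
snake-from-cells cs path cs≢[] in-grid with positions cs in-grid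
... | ps , refl = wordOf ps , wordOf-InW2 path′ , wordOf-IsSnake path′ (cs≢[] ∘ cong (map toCell)) ,
                  trans (filledCount-wordOf (InducedPath⇒Unique Adjacent-irrefl path′))
                        (sym (length-map toCell ps))
  where
  path′ : InducedPath Adjacent ps
  path′ = InducedPath-map⁻ path

-- Hairpins

hairpin : List Cell → List Cell
hairpin M = (0 , 0) ∷ M ++ [ (0 , 2) ]

length-hairpin : ∀ M → length (hairpin M) ≡ 2 + length M
length-hairpin M = cong suc (trans (length-++ M) (ℕ.+-comm (length M) 1))

downward-path-avoids-east-of-origin : ∀ {cs} → InducedPath Adj ((0 , 0) ∷ (1 , 0) ∷ cs) →
                                      All ((0 , 1) ≢_) ((0 , 0) ∷ (1 , 0) ∷ cs)
downward-path-avoids-east-of-origin (_ , apart , _) =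
  (λ ()) ∷ (λ ()) ∷ All.map (λ (_ , ¬adj) east≡c → ¬adj (subst (Adj (0 , 0)) east≡c refl)) apart

capped-InducedPath : ∀ {j cap M} → InducedPath Adj (cap ++ [ (j , 0) ]) →
                     AllApart Adj cap (map (shift (suc j)) (hairpin M)) → InducedPath Adj (hairpin M) →
                     InducedPath Adj (cap ++ (j , 0) ∷ map (shift (suc j)) (hairpin M))
capped-InducedPath {j} {M = M} top apart path =
  InducedPath-++ top (InducedPath-shift (suc j) path) (Adj-below (j , 0)) junction apart
  where
  junction : All (Apart Adj (j , 0)) (map (shift (suc j)) (M ++ [ (0 , 2) ]))
  junction = All-Apart-below (ℕ.n<1+n j) (shift-rows (suc j) _)
               (All-≢-shift (suc j) (AllPairs.head (InducedPath⇒Unique Adj-irrefl path)))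

descent ascent : List Cell
descent = (1 , 0) ∷ (1 , 1) ∷ (2 , 1) ∷ (3 , 1) ∷ (3 , 0) ∷ (4 , 0) ∷ []
ascent  = (4 , 2) ∷ (4 , 3) ∷ (3 , 3) ∷ (2 , 3) ∷ (1 , 3) ∷ (0 , 3) ∷ []

wrap : List Cell → List Cell
wrap M = descent ++ (5 , 0) ∷ map (shift 6) (hairpin M) ++ (5 , 2) ∷ ascent

wrap-InducedPath : ∀ {M} → InducedPath Adj (hairpin M) → InducedPath Adj (hairpin (wrap M))
wrap-InducedPath {M} path = subst (InducedPath Adj) (cong (λ cs → top ++ (5 , 0) ∷ (6 , 0) ∷ cs) reassociate)
  (InducedPath-++ {xs = top ++ (5 , 0) ∷ lower-half} upper-path (from-yes (inducedPathᶜ? ((5 , 2) ∷ rising)))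
    refl (from-yes (all? (apart? _≟ᶜ_ adj? (6 , 2)) rising)) halves-apart)
  where
  top rising lower-half : List Cell
  top        = (0 , 0) ∷ descent
  rising     = ascent ++ [ (0 , 2) ]
  lower-half = map (shift 6) ((0 , 0) ∷ M)

  upper-path : InducedPath Adj ((top ++ (5 , 0) ∷ lower-half) ++ [ (6 , 2) ])
  upper-path = subst (λ cs → InducedPath Adj (top ++ (5 , 0) ∷ (6 , 0) ∷ cs)) (map-++ (shift 6) M [ (0 , 2) ])
    (capped-InducedPath {j = 5} {cap = top} (from-yes (inducedPathᶜ? (top ++ [ (5 , 0) ])))
      (AllApart-far (from-yes (above? 6 top)) (shift-rows 6 (hairpin M))) path)

  beside-end : All (Apart Adj (5 , 2)) lower-half
  beside-end = All-Apart-below (ℕ.n<1+n 5) (shift-rows 6 ((0 , 0) ∷ M))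
    (All-≢-shift 6 {c = (0 , 2)} (All.map ≢-sym (AllPairs-∷ʳ⁻ (InducedPath⇒Unique Adj-irrefl path))))

  halves-apart : AllApart Adj (top ++ (5 , 0) ∷ lower-half) ((5 , 2) ∷ rising)
  halves-apart = All.++⁺ {xs = top ++ [ (5 , 0) ]}
    (from-yes (allApartᶜ? (top ++ [ (5 , 0) ]) ((5 , 2) ∷ rising)))
    (AllApart-sym (λ {x} {y} → Adj-sym {x} {y})
      (beside-end ∷ AllApart-far (from-yes (above? 6 rising)) (shift-rows 6 ((0 , 0) ∷ M))))

  reassociate : map (shift 6) M ++ (6 , 2) ∷ (5 , 2) ∷ rising ≡
                (map (shift 6) (M ++ [ (0 , 2) ]) ++ (5 , 2) ∷ ascent) ++ [ (0 , 2) ]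
  reassociate = sym (begin
    (map (shift 6) (M ++ [ (0 , 2) ]) ++ (5 , 2) ∷ ascent) ++ [ (0 , 2) ]
      ≡⟨ cong (λ cs → (cs ++ (5 , 2) ∷ ascent) ++ [ (0 , 2) ]) (map-++ (shift 6) M _) ⟩
    ((map (shift 6) M ++ [ (6 , 2) ]) ++ (5 , 2) ∷ ascent) ++ [ (0 , 2) ]
      ≡⟨ ++-assoc (map (shift 6) M ++ [ (6 , 2) ]) ((5 , 2) ∷ ascent) _ ⟩
    (map (shift 6) M ++ [ (6 , 2) ]) ++ (5 , 2) ∷ rising
      ≡⟨ ++-assoc (map (shift 6) M) [ (6 , 2) ] ((5 , 2) ∷ rising) ⟩
    map (shift 6) M ++ (6 , 2) ∷ (5 , 2) ∷ rising
      ∎)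
    where open ≡-Reasoning

wrap-InGrid : ∀ {H M} → All (InGrid H 4) (hairpin M) → All (InGrid (6 + H) 4) (hairpin (wrap M))
wrap-InGrid {H} in-grid = All.++⁺ {xs = (0 , 0) ∷ descent ++ [ (5 , 0) ]}
  (frame (from-yes (inGrid? 6 4 ((0 , 0) ∷ descent ++ [ (5 , 0) ]))))
  (All.++⁺ (All.++⁺ (InGrid-shift 6 in-grid) (frame (from-yes (inGrid? 6 4 ((5 , 2) ∷ ascent)))))
           (frame (from-yes (inGrid? 6 4 [ (0 , 2) ]))))
  where
  frame : ∀ {cs} → All (InGrid 6 4) cs → All (InGrid (6 + H) 4) cs
  frame = All.map (InGrid-mono (ℕ.m≤m+n 6 H))

length-wrap : ∀ M → length (wrap M) ≡ 16 + length M
length-wrap M = cong (7 +_) (begin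
  length (map (shift 6) (hairpin M) ++ (5 , 2) ∷ ascent) ≡⟨ length-++ (map (shift 6) (hairpin M)) ⟩
  length (map (shift 6) (hairpin M)) + 7                 ≡⟨ cong (_+ 7) (length-map (shift 6) (hairpin M)) ⟩
  length (hairpin M) + 7                                 ≡⟨ cong (_+ 7) (length-hairpin M) ⟩
  2 + length M + 7                                       ≡⟨ cong (2 +_) (ℕ.+-comm (length M) 7) ⟩
  9 + length M                                           ∎)
  where open ≡-Reasoning

interior : ℕ → List Cell
interior zero          = (1 , 0) ∷ (2 , 0) ∷ (2 , 1) ∷ (2 , 2) ∷ (2 , 3) ∷ (1 , 3) ∷ (0 , 3) ∷ []
interior (suc zero)    = (1 , 0) ∷ (1 , 1) ∷ (2 , 1) ∷ (3 , 1) ∷ (3 , 0) ∷ (4 , 0) ∷ (5 , 0) ∷ (5 , 1) ∷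
                         (5 , 2) ∷ (5 , 3) ∷ (4 , 3) ∷ (3 , 3) ∷ (2 , 3) ∷ (1 , 3) ∷ (0 , 3) ∷ []
interior (suc (suc n)) = wrap (interior n)

hairpin-InducedPath : ∀ n → InducedPath Adj (hairpin (interior n))
hairpin-InducedPath zero          = from-yes (inducedPathᶜ? (hairpin (interior 0)))
hairpin-InducedPath (suc zero)    = from-yes (inducedPathᶜ? (hairpin (interior 1)))
hairpin-InducedPath (suc (suc n)) = wrap-InducedPath (hairpin-InducedPath n)

hairpin-InGrid : ∀ n → All (InGrid (3 + n * 3) 4) (hairpin (interior n))
hairpin-InGrid zero          = from-yes (inGrid? 3 4 (hairpin (interior 0)))
hairpin-InGrid (suc zero)    = from-yes (inGrid? 6 4 (hairpin (interior 1)))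
hairpin-InGrid (suc (suc n)) = wrap-InGrid (hairpin-InGrid n)

length-hairpin-interior : ∀ n → length (hairpin (interior n)) ≡ 9 + n * 8
length-hairpin-interior n = trans (length-hairpin (interior n)) (cong (2 +_) (length-interior n))
  where
  length-interior : ∀ n → length (interior n) ≡ 7 + n * 8
  length-interior zero          = refl
  length-interior (suc zero)    = refl
  length-interior (suc (suc n)) = trans (length-wrap (interior n)) (cong (16 +_) (length-interior n))

hairpin-avoids-east-of-origin : ∀ n → All ((0 , 1) ≢_) (hairpin (interior n))
hairpin-avoids-east-of-origin zero    = downward-path-avoids-east-of-origin (hairpin-InducedPath 0)
hairpin-avoids-east-of-origin (suc zero) = downward-path-avoids-east-of-origin (hairpin-InducedPath 1)
hairpin-avoids-east-of-origin n@(suc (suc _)) = downward-path-avoids-east-of-origin (hairpin-InducedPath n)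

capped : List Cell → ℕ → ℕ → List Cell
capped cap j n = cap ++ (j , 0) ∷ map (shift (suc j)) (hairpin (interior n))

capped-InGrid : ∀ cap j n → All (InGrid (suc j) 4) cap → All (InGrid (suc j + (3 + n * 3)) 4) (capped cap j n)
capped-InGrid cap j n in-grid = All.++⁺ (All.map (InGrid-mono (ℕ.m≤m+n (suc j) _)) in-grid)
  ((s≤s (ℕ.m≤m+n j _) , s≤s z≤n) ∷ InGrid-shift (suc j) (hairpin-InGrid n))

length-capped : ∀ cap j n → length (capped cap j n) ≡ length cap + (10 + n * 8)
length-capped cap j n = trans (length-++ cap)
  (cong (λ l → length cap + suc l)
        (trans (length-map (shift (suc j)) (hairpin (interior n))) (length-hairpin-interior n)))

-- Snakes of excess ê(h)

whole-minus-thirds : ∀ n m e → n * 3 ≡ m + e → ℤ.+ n / 1 - ℤ.+ m / 3 ≡ ℤ.+ e / 3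
whole-minus-thirds n m e eq = toℚᵘ-injective (begin
  toℚᵘ (ℤ.+ n / 1 - ℤ.+ m / 3)
    ≈⟨ toℚᵘ-homo-+ (ℤ.+ n / 1) _ ⟩
  toℚᵘ (ℤ.+ n / 1) ℚᵘ.+ toℚᵘ (Data.Rational.- (ℤ.+ m / 3))
    ≈⟨ ℚᵘ.+-cong (toℚᵘ-fromℚᵘ (ℚᵘ.mkℚᵘ (ℤ.+ n) 0))
                 (ℚᵘ.≃-trans (toℚᵘ-homo‿- (ℤ.+ m / 3)) (ℚᵘ.-‿cong (toℚᵘ-fromℚᵘ (ℚᵘ.mkℚᵘ (ℤ.+ m) 2)))) ⟩
  ℚᵘ.mkℚᵘ (ℤ.+ n) 0 ℚᵘ.- ℚᵘ.mkℚᵘ (ℤ.+ m) 2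
    ≈⟨ ℚᵘ.*≡* numerators ⟩
  ℚᵘ.mkℚᵘ (ℤ.+ e) 2
    ≈⟨ toℚᵘ-fromℚᵘ (ℚᵘ.mkℚᵘ (ℤ.+ e) 2) ⟨
  toℚᵘ (ℤ.+ e / 3) ∎)
  where
  open ℚᵘ.≃-Reasoning
  cancel : ∀ (a b : ℤ.ℤ) → ((a ℤ.+ b) ℤ.+ ℤ.- a ℤ.* ℤ.+ 1) ℤ.* ℤ.+ 3 ≡ b ℤ.* ℤ.+ 3
  cancel = ℤ-Solver.solve-∀
  numerators : (ℤ.+ n ℤ.* ℤ.+ 3 ℤ.+ ℤ.- ℤ.+ m ℤ.* ℤ.+ 1) ℤ.* ℤ.+ 3 ≡ ℤ.+ e ℤ.* ℤ.+ 3
  numerators = trans (cong (λ x → (x ℤ.+ ℤ.- ℤ.+ m ℤ.* ℤ.+ 1) ℤ.* ℤ.+ 3)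
                           (trans (sym (ℤ.pos-* n 3)) (trans (cong ℤ.+_ eq) (ℤ.pos-+ m e))))
                     (cancel (ℤ.+ m) (ℤ.+ e))

count-periodic : ∀ {L h e} n → L * 3 ≡ 2 * h * 4 + e → (L + n * 8) * 3 ≡ 2 * (h + n * 3) * 4 + e
count-periodic {L} {h} {e} n eq = begin
  (L + n * 8) * 3           ≡⟨ expand L n ⟩
  L * 3 + n * 24            ≡⟨ cong (_+ n * 24) eq ⟩
  2 * h * 4 + e + n * 24    ≡⟨ regroup h e n ⟩
  2 * (h + n * 3) * 4 + e   ∎
  where
  open ≡-Reasoning
  expand : ∀ L n → (L + n * 8) * 3 ≡ L * 3 + n * 24
  expand = ℕ-Solver.solve-∀
  regroup : ∀ h e n → 2 * h * 4 + e + n * 24 ≡ 2 * (h + n * 3) * 4 + e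
  regroup = ℕ-Solver.solve-∀

eHat-periodic : ∀ h n → eHat (h + n * 3) ≡ eHat h
eHat-periodic h n rewrite [m+kn]%n≡m%n h n 3 {{_}} = refl

SnakeOfExcessÊ : ℕ → Set
SnakeOfExcessÊ h = Σ[ S ∈ Word h 4 ] (InW2 S × IsSnake S × excess S ≡ eHat h)

snake-of-excess-ê : ∀ {h} e (cs : List Cell) → InducedPath Adj cs → cs ≢ [] → All (InGrid h 4) cs →
                 length cs * 3 ≡ 2 * h * 4 + e → eHat h ≡ ℤ.+ e / 3 → SnakeOfExcessÊ h
snake-of-excess-ê {h} e cs path cs≢[] in-grid count ê with snake-from-cells cs path cs≢[] in-grid
... | S , inW2 , snake , filled≡ =
  S , inW2 , snake ,
  trans (whole-minus-thirds (filledCount S) (2 * h * 4) e (trans (cong (_* 3) filled≡) count)) (sym ê)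

hairpin-snake : ∀ n → SnakeOfExcessÊ (3 + n * 3)
hairpin-snake n = snake-of-excess-ê 3 (hairpin (interior n)) (hairpin-InducedPath n) (λ ()) (hairpin-InGrid n)
  (trans (cong (_* 3) (length-hairpin-interior n)) (count-periodic {9} {3} n refl)) (eHat-periodic 3 n)

two-row-cap four-row-cap-top four-row-cap : List Cell
two-row-cap      = (0 , 3) ∷ (0 , 2) ∷ (0 , 1) ∷ (0 , 0) ∷ []
four-row-cap-top = (1 , 0) ∷ (0 , 0) ∷ (0 , 1) ∷ (0 , 2) ∷ (0 , 3) ∷ (1 , 3) ∷ (2 , 3) ∷ (2 , 2) ∷ (2 , 1) ∷ []
four-row-cap     = four-row-cap-top ++ [ (3 , 1) ]

two-row-capped-snake : ∀ n → SnakeOfExcessÊ (5 + n * 3)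
two-row-capped-snake n = snake-of-excess-ê 2 (capped two-row-cap 1 n)
  (capped-InducedPath (from-yes (inducedPathᶜ? (two-row-cap ++ [ (1 , 0) ])))
    (AllApart-far (from-yes (above? 2 two-row-cap)) (shift-rows 2 (hairpin (interior n))))
    (hairpin-InducedPath n))
  (λ ()) (capped-InGrid two-row-cap 1 n (from-yes (inGrid? 2 4 two-row-cap)))
  (trans (cong (_* 3) (length-capped two-row-cap 1 n)) (count-periodic {14} {5} n refl)) (eHat-periodic 5 n)

four-row-capped-snake : ∀ n → SnakeOfExcessÊ (7 + n * 3)
four-row-capped-snake n = snake-of-excess-ê 4 (capped four-row-cap 3 n)
  (capped-InducedPath (from-yes (inducedPathᶜ? (four-row-cap ++ [ (3 , 0) ]))) apart (hairpin-InducedPath n))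
  (λ ()) (capped-InGrid four-row-cap 3 n (from-yes (inGrid? 4 4 four-row-cap)))
  (trans (cong (_* 3) (length-capped four-row-cap 3 n)) (count-periodic {20} {7} n refl)) (eHat-periodic 7 n)
  where
  -- The last cap cell (3,1) lies right above the shift of (0,1), which no hairpin visits.
  apart : AllApart Adj four-row-cap (map (shift 4) (hairpin (interior n)))
  apart = All.++⁺ (AllApart-far (from-yes (above? 4 four-row-cap-top)) (shift-rows 4 (hairpin (interior n))))
    (All-Apart-below (ℕ.n<1+n 3) (shift-rows 4 (hairpin (interior n)))
      (All-≢-shift 4 (hairpin-avoids-east-of-origin n)) ∷ [])

snake-of-height : ∀ h → 4 < h → SnakeOfExcessÊ h
snake-of-height h 4<h = subst SnakeOfExcessÊ h≡ (by-residue (k % 3) (k ℕ./ 3) (m%n<n k 3))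
  where
  k : ℕ
  k = h ∸ 5
  h≡ : 5 + (k % 3 + k ℕ./ 3 * 3) ≡ h
  h≡ = trans (cong (5 +_) (sym (m≡m%n+[m/n]*n k 3))) (ℕ.m+[n∸m]≡n 4<h)
  by-residue : ∀ r q → r < 3 → SnakeOfExcessÊ (5 + (r + q * 3))
  by-residue 0 q _ = two-row-capped-snake q
  by-residue 1 q _ = hairpin-snake (suc q)
  by-residue 2 q _ = four-row-capped-snake q
  by-residue (suc (suc (suc _))) _ (s≤s (s≤s (s≤s ())))

InW2? : ∀ {h w} (W : Word h w) → Dec (InW2 W)
InW2? W = map′ (λ f (i , j) → f i j) (λ g i j → g (i , j))
  (Fin.all? λ i → Fin.all? λ j → (W i j Bool.≟ true) →-dec (degree W (i , j) ℕ.≤? 2))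

square-outline : Word 4 4
square-outline i j = on-edge i ∨ on-edge j
  where
  on-edge : Fin 4 → Bool
  on-edge k = (toℕ k ℕ.≡ᵇ 0) ∨ (toℕ k ℕ.≡ᵇ 3)

lemma5 : (h : ℕ) → 4 Data.Nat.≤ h →
    (Σ[ W ∈ Word h 4 ] (InW2 W × eHat h Data.Rational.≤ excess W))
    × (4 < h → Σ[ S ∈ Word h 4 ] (InW2 S × IsSnake S × excess S ≡ eHat h))
lemma5 h 4≤h with ℕ.m≤n⇒m<n∨m≡n 4≤h
... | inj₂ refl = (square-outline , from-yes (InW2? square-outline) , ℚ.≤-reflexive refl) ,
                  λ 4<4 → ⊥-elim (ℕ.<-irrefl refl 4<4)
... | inj₁ 4<h with snake-of-height h 4<h
...   | snake@(S , inW2 , _ , excess≡) = (S , inW2 , ℚ.≤-reflexive (sym excess≡)) , λ _ → snake
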